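{- With $P_n$ and $C_n$ as in the context, \[\sum_{n\ge0}\mathrm G_{P_n}(\mathbf x;q+1)z^n=\frac{1}{1-\sum_{i\ge1}q^{i-1}z^i\mathrm e_i(\mathbf x)},\qquad \sum_{n\ge1}\mathrm G_{C_n}(\mathbf x;q+1)z^n=\frac{\sum_{i\ge1}i\,q^{i-1}z^i\mathrm e_i(\mathbf x)}{1-\sum_{i\ge1}q^{i-1}z^i\mathrm e_i(\mathbf x)}.\]
   Context: For $\mathbf a=(a_1,\dots,a_n)$, $\Gamma_{\mathbf a}$ is the directed graph on $[n]$ with edges $i\to i+1,\dots,i\to i+a_i$ (labels mod $n$), and $\mathrm G_{\mathbf a}(\mathbf x;q)=\sum_F\mathbf x^Fq^{\mathrm{asc}_{\mathbf a}(F)}$ over all maps $F:[n]\to\mathbb Z_{>0}$, $\mathbf x^F=\prod_vx_{F(v)}$, $\mathrm{asc}_{\mathbf a}(F)$ the number of edges $i\to j$ with $F(i)<F(j)$. $P_n$ is $\Gamma_{(1,\dots,1,0)}$ for $n\ge1$ ($P_1$ a single vertex), with $\mathrm G_{P_0}=1$. $C_1$ is a single vertex and, for $n\ge2$, $C_n=\Gamma_{(1,\dots,1)}$ (edges $i\to i+1$ mod $n$; for $n=2$ edges $1\to2$, $2\to1$). -}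

module Defs where

open import Level using (Level)
open import Algebra.Bundles using (CommutativeRing)
open import Data.Nat as ℕ using (ℕ; zero; suc; _∸_)
open import Data.Nat.DivMod using (_mod_)
open import Data.Fin as Fin using (Fin; toℕ)
open import Data.Bool using (Bool; true; false; if_then_else_)
open import Data.List as List using (List; []; _∷_; length; filter; concatMap; map; applyUpTo; allFin)
open import Data.Product using (_×_; _,_; proj₁; proj₂)
open import Data.Vec.Functional using (Vector) renaming (_∷_ to _◂_)
open import Relation.Nullary.Decidable using (⌊_⌋)
open import Data.Nat.ListAction using (sum)

-- The graph Γ_a on vertex set Fin n (= [n], shifted to 0-based labels):
-- for each vertex i, the edges i → i+k (mod n), k = 1, …, a_i,
-- listed with multiplicity.

edges : (n : ℕ) → (Fin n → ℕ) → List (Fin n × Fin n)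
edges zero    a = []
edges (suc m) a =
  concatMap (λ i → map (λ k → (i , (toℕ i ℕ.+ k) mod suc m)) (applyUpTo suc (a i)))
            (allFin (suc m))

-- asc_a(F): number of edges i → j of Γ_a with F(i) < F(j).
-- Colours are restricted to the first m positive integers {1,…,m} ≅ Fin m
-- (truncation x_{m+1} = x_{m+2} = … = 0), with the usual order.
asc : {m : ℕ} (n : ℕ) → (Fin n → ℕ) → (Fin n → Fin m) → ℕ
asc n a F = length (filter (λ e → F (proj₁ e) Fin.<? F (proj₂ e)) (edges n a))

aP : (n : ℕ) → Fin n → ℕ
aP n i = if ⌊ suc (toℕ i) ℕ.<? n ⌋ then 1 else 0

-- a-vector of C_n : (1,…,1) for n ≥ 2; C_1 is a single vertex (no edges).
aC : (n : ℕ) → Fin n → ℕ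
aC (suc zero) _ = 0
aC _          _ = 1

-- Finite sums over all maps Fin n → A, where the list enumerates A.

module Over {c ℓ : Level} (R : CommutativeRing c ℓ) where
  open CommutativeRing R

  sumL : {B : Set} → List B → (B → Carrier) → Carrier
  sumL []       f = 0#
  sumL (b ∷ bs) f = f b + sumL bs f

  sumMaps : {A : Set} (n : ℕ) → List A → ((Fin n → A) → Carrier) → Carrier
  sumMaps zero    as f = f (λ ())
  sumMaps (suc n) as f = sumL as (λ b → sumMaps n as (λ g → f (b ◂ g)))

  prodFin : (n : ℕ) → (Fin n → Carrier) → Carrier
  prodFin zero    f = 1#
  prodFin (suc n) f = f Fin.zero * prodFin n (λ i → f (Fin.suc i))

  pow : Carrier → ℕ → Carrier
  pow y zero    = 1#
  pow y (suc k) = y * pow y k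

  count : (m : ℕ) → (Fin m → Bool) → ℕ
  count m S = sum (map (λ j → if S j then 1 else 0) (allFin m))

  G : (m n : ℕ) → (Fin n → ℕ) → (x : Fin m → Carrier) → (t : Carrier) → Carrier
  G m n a x t = sumMaps n (allFin m) (λ F → prodFin n (λ v → x (F v)) * pow t (asc n a F))

  e : (m : ℕ) → ℕ → (Fin m → Carrier) → Carrier
  e m i x = sumMaps m (true ∷ false ∷ [])
              (λ S → if ⌊ count m S ℕ.≟ i ⌋
                       then prodFin m (λ j → if S j then x j else 1#)
                       else 0#)

  Series : Set c
  Series = ℕ → Carrier

  _⋆_ : Series → Series → Series
  (f ⋆ g) n = sumL (applyUpTo (λ k → k) (suc n)) (λ k → f k * g (n ∸ k))

  _≈ˢ_ : Series → Series → Set ℓ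
  f ≈ˢ g = ∀ n → f n ≈ g n

  oneˢ : Series
  oneˢ zero    = 1#
  oneˢ (suc _) = 0#

  Aˢ : (m : ℕ) → (Fin m → Carrier) → Carrier → Series
  Aˢ m x q zero    = 0#
  Aˢ m x q (suc j) = pow q j * e m (suc j) x

  Bˢ : (m : ℕ) → (Fin m → Carrier) → Carrier → Series
  Bˢ m x q zero    = 0#
  Bˢ m x q (suc j) = sumL (applyUpTo (λ k → k) (suc j)) (λ _ → 1#) * (pow q j * e m (suc j) x)

  oneMinusAˢ : (m : ℕ) → (Fin m → Carrier) → Carrier → Series
  oneMinusAˢ m x q n = oneˢ n - Aˢ m x q n

  Pˢ : (m : ℕ) → (Fin m → Carrier) → Carrier → Series
  Pˢ m x q n = G m n (aP n) x (q + 1#)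

  Cˢ : (m : ℕ) → (Fin m → Carrier) → Carrier → Series
  Cˢ m x q zero    = 0#
  Cˢ m x q (suc n) = G m (suc n) (aC (suc n)) x (q + 1#)

module Submission where

-- Put t = q + 1 and expand t ^ [a < b] = 1 + q · [a < b] along every edge. A colouring of a
-- path together with a choice of one of the two terms at each edge then splits into maximal
-- blocks, strictly increasing in colour, joined at the edges where 1 was chosen; a block on
-- i vertices contributes q ^ (i - 1) · e_i. Hence P = Σ G_{P_n}(x; q + 1) zⁿ satisfies the
-- renewal equation P = 1 + A · P with A = Σ q ^ (i - 1) e_i zⁱ, i.e. P · (1 - A) = 1; here the
-- blocks are organised as weighted walks, with the first break of a walk splitting off one block.
-- On the cycle the closing edge either takes the term 1, which leaves a path, or lies inside an
-- increasing block that wraps around; cutting a wrapped block on i vertices at the closing edge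
-- can be done in i - 1 ways, and with the block starting at the first vertex this gives the
-- numerator Σ i q ^ (i - 1) e_i zⁱ.

open import Level using (Level)
open import Algebra.Bundles using (CommutativeRing)
open import Data.Bool using (Bool; true; false; if_then_else_)
open import Data.Fin as Fin using (Fin; toℕ; inject₁; fromℕ)
import Data.Fin.Properties as Fin
open import Data.List using (List; []; _∷_; _++_; length; filter; concatMap; map; tabulate; applyUpTo; upTo; allFin)
open import Data.List.Properties using (filter-++; length-++; map-tabulate)
import Data.Nat.ListAction as ListAction
open import Data.Nat as ℕ using (ℕ; zero; suc; _∸_)
import Data.Nat.Properties as ℕ
open import Data.Nat.DivMod using (_mod_; _%_; m<n⇒m%n≡m; n%n≡0)
open import Data.Product using (_×_; _,_; proj₁; proj₂)
open import Data.Vec.Functional using () renaming (_∷_ to _◂_)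
open import Relation.Nullary.Decidable using (Dec; ⌊_⌋; yes; no; dec-true; dec-false; isYes≗does)
open import Relation.Nullary.Negation using (contradiction)
open import Relation.Unary using (Pred; Decidable)
open import Relation.Binary.PropositionalEquality as ≡ using (_≡_; module ≡-Reasoning)

open import Defs

module Ascents where
  open ≡ using (refl; cong; cong₂; sym; trans)
  open import Algebra.Properties.Monoid.Sum ℕ.+-0-monoid using (sum; sum-cong-≗; sum-init-last)

  ascent : ∀ {m} → Fin m → Fin m → ℕ
  ascent b c = if ⌊ b Fin.<? c ⌋ then 1 else 0

  pathAsc : ∀ {m l} → (Fin (suc l) → Fin m) → ℕ
  pathAsc {l = l} F = sum {l} (λ j → ascent (F (inject₁ j)) (F (Fin.suc j)))

  length-filter-concatMap : ∀ {A B : Set} {p} {P : Pred B p} (P? : Decidable P) (f : A → List B)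
                            {n} (g : Fin n → A) →
                            length (filter P? (concatMap f (tabulate g))) ≡ sum (λ i → length (filter P? (f (g i))))
  length-filter-concatMap P? f {zero}  g = refl
  length-filter-concatMap P? f {suc n} g = begin
    length (filter P? (f (g Fin.zero) ++ concatMap f (tabulate (λ i → g (Fin.suc i)))))
      ≡⟨ cong length (filter-++ P? (f (g Fin.zero)) _) ⟩
    length (filter P? (f (g Fin.zero)) ++ filter P? (concatMap f (tabulate (λ i → g (Fin.suc i)))))
      ≡⟨ length-++ (filter P? (f (g Fin.zero))) ⟩
    length (filter P? (f (g Fin.zero))) ℕ.+ length (filter P? (concatMap f (tabulate (λ i → g (Fin.suc i)))))
      ≡⟨ cong (length (filter P? (f (g Fin.zero))) ℕ.+_) (length-filter-concatMap P? f (λ i → g (Fin.suc i))) ⟩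
    sum (λ i → length (filter P? (f (g i)))) ∎
    where open ≡-Reasoning

  length-filter-singleton : ∀ {B : Set} {p} {P : Pred B p} (P? : Decidable P) x →
                     length (filter P? (x ∷ [])) ≡ (if ⌊ P? x ⌋ then 1 else 0)
  length-filter-singleton P? x with P? x
  ... | yes _ = refl
  ... | no  _ = refl

  ascentsFrom : ∀ {m} n → (Fin (suc n) → ℕ) → (Fin (suc n) → Fin m) → Fin (suc n) → ℕ
  ascentsFrom n a F i = length (filter (λ e → F (proj₁ e) Fin.<? F (proj₂ e))
                                       (map (λ k → (i , (toℕ i ℕ.+ k) mod suc n)) (applyUpTo suc (a i))))

  asc-sum : ∀ {m} n a (F : Fin (suc n) → Fin m) → asc (suc n) a F ≡ sum (ascentsFrom n a F)
  asc-sum n a F = length-filter-concatMap (λ e → F (proj₁ e) Fin.<? F (proj₂ e))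
                    (λ i → map (λ k → (i , (toℕ i ℕ.+ k) mod suc n)) (applyUpTo suc (a i))) (λ i → i)

  ascentsFrom-one : ∀ {m} n a (F : Fin (suc n) → Fin m) i → a i ≡ 1 →
                    ascentsFrom n a F i ≡ ascent (F i) (F ((toℕ i ℕ.+ 1) mod suc n))
  ascentsFrom-one n a F i ai≡1 rewrite ai≡1 = length-filter-singleton (λ e → F (proj₁ e) Fin.<? F (proj₂ e)) _

  ascentsFrom-zero : ∀ {m} n a (F : Fin (suc n) → Fin m) i → a i ≡ 0 → ascentsFrom n a F i ≡ 0
  ascentsFrom-zero n a F i ai≡0 rewrite ai≡0 = refl

  inject₁+1-mod : ∀ {n} (j : Fin n) → (toℕ (inject₁ j) ℕ.+ 1) mod suc n ≡ Fin.suc j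
  inject₁+1-mod {n} j = Fin.toℕ-injective (begin
    toℕ ((toℕ (inject₁ j) ℕ.+ 1) mod suc n) ≡⟨ Fin.toℕ-fromℕ< _ ⟩
    (toℕ (inject₁ j) ℕ.+ 1) % suc n        ≡⟨ cong (λ k → (k ℕ.+ 1) % suc n) (Fin.toℕ-inject₁ j) ⟩
    (toℕ j ℕ.+ 1) % suc n                  ≡⟨ cong (_% suc n) (ℕ.+-comm (toℕ j) 1) ⟩
    suc (toℕ j) % suc n                    ≡⟨ m<n⇒m%n≡m (ℕ.s≤s (Fin.toℕ<n j)) ⟩
    suc (toℕ j)                            ∎)
    where open ≡-Reasoning

  fromℕ+1-mod : ∀ n → (toℕ (fromℕ n) ℕ.+ 1) mod suc n ≡ Fin.zero
  fromℕ+1-mod n = Fin.toℕ-injective (begin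
    toℕ ((toℕ (fromℕ n) ℕ.+ 1) mod suc n) ≡⟨ Fin.toℕ-fromℕ< _ ⟩
    (toℕ (fromℕ n) ℕ.+ 1) % suc n         ≡⟨ cong (λ k → (k ℕ.+ 1) % suc n) (Fin.toℕ-fromℕ n) ⟩
    (n ℕ.+ 1) % suc n                     ≡⟨ cong (_% suc n) (ℕ.+-comm n 1) ⟩
    suc n % suc n                         ≡⟨ n%n≡0 (suc n) ⟩
    0                                     ∎)
    where open ≡-Reasoning

  aP-inject₁ : ∀ n (j : Fin n) → aP (suc n) (inject₁ j) ≡ 1
  aP-inject₁ n j = cong (λ b → if b then 1 else 0)
    (trans (isYes≗does _) (dec-true (suc (toℕ (inject₁ j)) ℕ.<? suc n) (ℕ.s≤s (Fin.inject₁ℕ< j))))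

  aP-fromℕ : ∀ n → aP (suc n) (fromℕ n) ≡ 0
  aP-fromℕ n = cong (λ b → if b then 1 else 0)
    (trans (isYes≗does _) (dec-false (suc (toℕ (fromℕ n)) ℕ.<? suc n) (λ lt → ℕ.<-irrefl (Fin.toℕ-fromℕ n) (ℕ.≤-pred lt))))

  asc-path : ∀ {m} n (F : Fin (suc n) → Fin m) → asc (suc n) (aP (suc n)) F ≡ pathAsc F
  asc-path n F = begin
    asc (suc n) (aP (suc n)) F
      ≡⟨ asc-sum n (aP (suc n)) F ⟩
    sum (ascentsFrom n (aP (suc n)) F)
      ≡⟨ sum-init-last (ascentsFrom n (aP (suc n)) F) ⟩
    sum (λ j → ascentsFrom n (aP (suc n)) F (inject₁ j)) ℕ.+ ascentsFrom n (aP (suc n)) F (fromℕ n)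
      ≡⟨ cong₂ ℕ._+_ (sum-cong-≗ out) (ascentsFrom-zero n (aP (suc n)) F (fromℕ n) (aP-fromℕ n)) ⟩
    pathAsc F ℕ.+ 0
      ≡⟨ ℕ.+-identityʳ _ ⟩
    pathAsc F ∎
    where
      open ≡-Reasoning
      out : ∀ j → ascentsFrom n (aP (suc n)) F (inject₁ j) ≡ ascent (F (inject₁ j)) (F (Fin.suc j))
      out j = trans (ascentsFrom-one n (aP (suc n)) F (inject₁ j) (aP-inject₁ n j))
                    (cong (λ v → ascent (F (inject₁ j)) (F v)) (inject₁+1-mod j))

  asc-cycle : ∀ {m} n (F : Fin (suc (suc n)) → Fin m) →
              asc (suc (suc n)) (aC (suc (suc n))) F ≡ pathAsc F ℕ.+ ascent (F (fromℕ (suc n))) (F Fin.zero)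
  asc-cycle n F = begin
    asc (suc (suc n)) (aC (suc (suc n))) F
      ≡⟨ asc-sum (suc n) (aC (suc (suc n))) F ⟩
    sum (ascentsFrom (suc n) (aC (suc (suc n))) F)
      ≡⟨ sum-init-last (ascentsFrom (suc n) (aC (suc (suc n))) F) ⟩
    sum (λ j → ascentsFrom (suc n) (aC (suc (suc n))) F (inject₁ j)) ℕ.+ ascentsFrom (suc n) (aC (suc (suc n))) F (fromℕ (suc n))
      ≡⟨ cong₂ ℕ._+_ (sum-cong-≗ out) closing ⟩
    pathAsc F ℕ.+ ascent (F (fromℕ (suc n))) (F Fin.zero) ∎
    where
      open ≡-Reasoning
      out : ∀ j → ascentsFrom (suc n) (aC (suc (suc n))) F (inject₁ j) ≡ ascent (F (inject₁ j)) (F (Fin.suc j))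
      out j = trans (ascentsFrom-one (suc n) (aC (suc (suc n))) F (inject₁ j) refl)
                    (cong (λ v → ascent (F (inject₁ j)) (F v)) (inject₁+1-mod j))
      closing : ascentsFrom (suc n) (aC (suc (suc n))) F (fromℕ (suc n)) ≡ ascent (F (fromℕ (suc n))) (F Fin.zero)
      closing = trans (ascentsFrom-one (suc n) (aC (suc (suc n))) F (fromℕ (suc n)) refl)
                      (cong (λ v → ascent (F (fromℕ (suc n))) (F v)) (fromℕ+1-mod (suc n)))

module Summation {c ℓ : Level} (R : CommutativeRing c ℓ) where
  open CommutativeRing R
  open Over R
  open import Algebra.Properties.CommutativeSemigroup +-commutativeSemigroup using (interchange)
  open import Relation.Binary.Reasoning.Setoid setoid

  sumL-cong : ∀ {B : Set} (l : List B) {f g : B → Carrier} → (∀ b → f b ≈ g b) → sumL l f ≈ sumL l g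
  sumL-cong []      f≈g = refl
  sumL-cong (b ∷ l) f≈g = +-cong (f≈g b) (sumL-cong l f≈g)

  sumL-zero : ∀ {B : Set} (l : List B) {f : B → Carrier} → (∀ b → f b ≈ 0#) → sumL l f ≈ 0#
  sumL-zero []      f≈0 = refl
  sumL-zero (b ∷ l) f≈0 = trans (+-cong (f≈0 b) (sumL-zero l f≈0)) (+-identityˡ 0#)

  sumL-+ : ∀ {B : Set} (l : List B) (f g : B → Carrier) → sumL l (λ b → f b + g b) ≈ sumL l f + sumL l g
  sumL-+ []      f g = sym (+-identityˡ 0#)
  sumL-+ (b ∷ l) f g = trans (+-cong refl (sumL-+ l f g)) (interchange _ _ _ _)

  sumL-*ˡ : ∀ {B : Set} (l : List B) (k : Carrier) (f : B → Carrier) → sumL l (λ b → k * f b) ≈ k * sumL l f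
  sumL-*ˡ []      k f = sym (zeroʳ k)
  sumL-*ˡ (b ∷ l) k f = trans (+-cong refl (sumL-*ˡ l k f)) (sym (distribˡ k _ _))

  sumL-const : ∀ {B : Set} (l : List B) (a : Carrier) → sumL l (λ _ → a) ≈ sumL l (λ _ → 1#) * a
  sumL-const []      a = sym (zeroˡ a)
  sumL-const (b ∷ l) a = trans (+-cong (sym (*-identityˡ a)) (sumL-const l a)) (sym (distribʳ a 1# _))

  sumL-comm : ∀ {A B : Set} (l : List A) (l′ : List B) (f : A → B → Carrier) →
              sumL l (λ a → sumL l′ (f a)) ≈ sumL l′ (λ b → sumL l (λ a → f a b))
  sumL-comm []      l′ f = sym (sumL-zero l′ (λ _ → refl))
  sumL-comm (a ∷ l) l′ f = trans (+-cong refl (sumL-comm l l′ f)) (sym (sumL-+ l′ (f a) _))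

  sumL-tabulate : ∀ {B : Set} {n} (g : Fin n → B) (f : B → Carrier) →
                  sumL (tabulate g) f ≡ sumL (allFin n) (λ i → f (g i))
  sumL-tabulate {n = zero}  g f = ≡.refl
  sumL-tabulate {n = suc n} g f = ≡.cong (f (g Fin.zero) +_)
    (≡.trans (sumL-tabulate (λ i → g (Fin.suc i)) f) (≡.sym (sumL-tabulate Fin.suc (λ i → f (g i)))))

  sumL-allFin-suc : ∀ {n} (f : Fin (suc n) → Carrier) →
                    sumL (allFin (suc n)) f ≡ f Fin.zero + sumL (allFin n) (λ i → f (Fin.suc i))
  sumL-allFin-suc f = ≡.cong (f Fin.zero +_) (sumL-tabulate Fin.suc f)

  sumL-applyUpTo : ∀ n (g : ℕ → ℕ) (h : ℕ → Carrier) → sumL (applyUpTo g n) h ≡ sumL (upTo n) (λ k → h (g k))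
  sumL-applyUpTo zero    g h = ≡.refl
  sumL-applyUpTo (suc n) g h = ≡.cong (h (g 0) +_)
    (≡.trans (sumL-applyUpTo n (λ k → g (suc k)) h) (≡.sym (sumL-applyUpTo n suc (λ k → h (g k)))))

  sumL-upTo-suc : ∀ n (h : ℕ → Carrier) → sumL (upTo (suc n)) h ≡ h 0 + sumL (upTo n) (λ k → h (suc k))
  sumL-upTo-suc n h = ≡.cong (h 0 +_) (sumL-applyUpTo n suc h)

  sumL-upTo-cong : ∀ n {h h′ : ℕ → Carrier} → (∀ k → k ℕ.< n → h k ≈ h′ k) → sumL (upTo n) h ≈ sumL (upTo n) h′
  sumL-upTo-cong zero    h≈h′ = refl
  sumL-upTo-cong (suc n) {h} {h′} h≈h′ = begin
    sumL (upTo (suc n)) h                  ≡⟨ sumL-upTo-suc n h ⟩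
    h 0 + sumL (upTo n) (λ k → h (suc k))   ≈⟨ +-cong (h≈h′ 0 (ℕ.s≤s ℕ.z≤n)) (sumL-upTo-cong n (λ k k<n → h≈h′ (suc k) (ℕ.s≤s k<n))) ⟩
    h′ 0 + sumL (upTo n) (λ k → h′ (suc k)) ≡⟨ ≡.sym (sumL-upTo-suc n h′) ⟩
    sumL (upTo (suc n)) h′                 ∎

  sumL-upTo-last : ∀ n (h : ℕ → Carrier) → sumL (upTo (suc n)) h ≈ sumL (upTo n) h + h n
  sumL-upTo-last zero    h = trans (+-identityʳ _) (sym (+-identityˡ _))
  sumL-upTo-last (suc n) h = begin
    sumL (upTo (suc (suc n))) h                             ≡⟨ sumL-upTo-suc (suc n) h ⟩
    h 0 + sumL (upTo (suc n)) (λ k → h (suc k))             ≈⟨ +-cong refl (sumL-upTo-last n (λ k → h (suc k))) ⟩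
    h 0 + (sumL (upTo n) (λ k → h (suc k)) + h (suc n))     ≈⟨ sym (+-assoc _ _ _) ⟩
    (h 0 + sumL (upTo n) (λ k → h (suc k))) + h (suc n)     ≡⟨ ≡.cong (_+ h (suc n)) (≡.sym (sumL-upTo-suc n h)) ⟩
    sumL (upTo (suc n)) h + h (suc n)                       ∎

  sumL-upTo-reverse : ∀ n (h : ℕ → Carrier) → sumL (upTo (suc n)) h ≈ sumL (upTo (suc n)) (λ k → h (n ∸ k))
  sumL-upTo-reverse zero    h = refl
  sumL-upTo-reverse (suc n) h = begin
    sumL (upTo (suc (suc n))) h                                     ≡⟨ sumL-upTo-suc (suc n) h ⟩
    h 0 + sumL (upTo (suc n)) (λ k → h (suc k))                     ≈⟨ +-cong refl (sumL-upTo-reverse n (λ k → h (suc k))) ⟩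
    h 0 + sumL (upTo (suc n)) (λ k → h (suc (n ∸ k)))               ≈⟨ +-comm _ _ ⟩
    sumL (upTo (suc n)) (λ k → h (suc (n ∸ k))) + h 0               ≈⟨ +-cong (sumL-upTo-cong (suc n) suc-∸) (reflexive (≡.cong h (≡.sym (ℕ.n∸n≡0 n)))) ⟩
    sumL (upTo (suc n)) (λ k → h (suc n ∸ k)) + h (suc n ∸ suc n)   ≈⟨ sym (sumL-upTo-last (suc n) (λ k → h (suc n ∸ k))) ⟩
    sumL (upTo (suc (suc n))) (λ k → h (suc n ∸ k))                 ∎
    where
      suc-∸ : ∀ k → k ℕ.< suc n → h (suc (n ∸ k)) ≈ h (suc n ∸ k)
      suc-∸ k k<1+n = reflexive (≡.cong h (≡.sym (ℕ.+-∸-assoc 1 (ℕ.≤-pred k<1+n))))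

  sumMaps-cong : ∀ {A : Set} n (as : List A) {f g : (Fin n → A) → Carrier} →
                 (∀ h → f h ≈ g h) → sumMaps n as f ≈ sumMaps n as g
  sumMaps-cong zero    as f≈g = f≈g _
  sumMaps-cong (suc n) as f≈g = sumL-cong as (λ b → sumMaps-cong n as (λ h → f≈g (b ◂ h)))

  sumMaps-zero : ∀ {A : Set} n (as : List A) {f : (Fin n → A) → Carrier} → (∀ h → f h ≈ 0#) → sumMaps n as f ≈ 0#
  sumMaps-zero zero    as f≈0 = f≈0 _
  sumMaps-zero (suc n) as f≈0 = sumL-zero as (λ b → sumMaps-zero n as (λ h → f≈0 (b ◂ h)))

  sumMaps-*ˡ : ∀ {A : Set} n (as : List A) (k : Carrier) (f : (Fin n → A) → Carrier) →
               sumMaps n as (λ h → k * f h) ≈ k * sumMaps n as f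
  sumMaps-*ˡ zero    as k f = refl
  sumMaps-*ˡ (suc n) as k f = trans (sumL-cong as (λ b → sumMaps-*ˡ n as k _)) (sumL-*ˡ as k _)

module Convolution {c ℓ : Level} (R : CommutativeRing c ℓ) where
  open CommutativeRing R
  open Over R
  open Summation R
  open import Algebra.Properties.Ring ring using (-‿distribˡ-*; -‿+-comm)
  open import Algebra.Properties.CommutativeSemigroup +-commutativeSemigroup using (interchange)
  open import Relation.Binary.Reasoning.Setoid setoid

  shift : Series → Series
  shift f zero    = 0#
  shift f (suc n) = f n

  shift-cong : ∀ {f g : Series} → f ≈ˢ g → shift f ≈ˢ shift g
  shift-cong f≈g zero    = refl
  shift-cong f≈g (suc n) = f≈g n

  ⋆-at-zero : (f g : Series) → (f ⋆ g) 0 ≈ f 0 * g 0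
  ⋆-at-zero f g = +-identityʳ _

  ⋆-at-suc : (f g : Series) (n : ℕ) → (f ⋆ g) (suc n) ≡ f 0 * g (suc n) + ((λ k → f (suc k)) ⋆ g) n
  ⋆-at-suc f g n = ≡.cong (f 0 * g (suc n) +_) (sumL-applyUpTo (suc n) suc (λ k → f k * g (suc n ∸ k)))

  ⋆-cong : ∀ {f f′ g g′ : Series} → f ≈ˢ f′ → g ≈ˢ g′ → (f ⋆ g) ≈ˢ (f′ ⋆ g′)
  ⋆-cong f≈f′ g≈g′ zero = +-cong (*-cong (f≈f′ 0) (g≈g′ 0)) refl
  ⋆-cong {f} {f′} {g} {g′} f≈f′ g≈g′ (suc n) = begin
    (f ⋆ g) (suc n)                                  ≡⟨ ⋆-at-suc f g n ⟩
    f 0 * g (suc n) + ((λ k → f (suc k)) ⋆ g) n       ≈⟨ +-cong (*-cong (f≈f′ 0) (g≈g′ (suc n))) (⋆-cong (λ k → f≈f′ (suc k)) g≈g′ n) ⟩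
    f′ 0 * g′ (suc n) + ((λ k → f′ (suc k)) ⋆ g′) n   ≡⟨ ≡.sym (⋆-at-suc f′ g′ n) ⟩
    (f′ ⋆ g′) (suc n)                                ∎

  ⋆-congˡ : ∀ {f f′ : Series} (g : Series) → f ≈ˢ f′ → (f ⋆ g) ≈ˢ (f′ ⋆ g)
  ⋆-congˡ g f≈f′ = ⋆-cong f≈f′ (λ _ → refl)

  ⋆-congʳ : ∀ (f : Series) {g g′ : Series} → g ≈ˢ g′ → (f ⋆ g) ≈ˢ (f ⋆ g′)
  ⋆-congʳ f g≈g′ = ⋆-cong (λ _ → refl) g≈g′

  ⋆-zeroˡ : (g : Series) → ((λ _ → 0#) ⋆ g) ≈ˢ (λ _ → 0#)
  ⋆-zeroˡ g zero    = trans (+-identityʳ _) (zeroˡ _)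
  ⋆-zeroˡ g (suc n) = trans (reflexive (⋆-at-suc _ g n)) (trans (+-cong (zeroˡ _) (⋆-zeroˡ g n)) (+-identityʳ _))

  ⋆-distribʳ-+ : (f f′ g : Series) → ((λ k → f k + f′ k) ⋆ g) ≈ˢ (λ n → (f ⋆ g) n + (f′ ⋆ g) n)
  ⋆-distribʳ-+ f f′ g zero = trans (+-identityʳ _) (trans (distribʳ _ _ _) (sym (+-cong (+-identityʳ _) (+-identityʳ _))))
  ⋆-distribʳ-+ f f′ g (suc n) = begin
    ((λ k → f k + f′ k) ⋆ g) (suc n)
      ≡⟨ ⋆-at-suc _ g n ⟩
    (f 0 + f′ 0) * g (suc n) + ((λ k → f (suc k) + f′ (suc k)) ⋆ g) n
      ≈⟨ +-cong (distribʳ _ _ _) (⋆-distribʳ-+ _ _ g n) ⟩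
    (f 0 * g (suc n) + f′ 0 * g (suc n)) + (((λ k → f (suc k)) ⋆ g) n + ((λ k → f′ (suc k)) ⋆ g) n)
      ≈⟨ interchange _ _ _ _ ⟩
    (f 0 * g (suc n) + ((λ k → f (suc k)) ⋆ g) n) + (f′ 0 * g (suc n) + ((λ k → f′ (suc k)) ⋆ g) n)
      ≡⟨ ≡.sym (≡.cong₂ _+_ (⋆-at-suc f g n) (⋆-at-suc f′ g n)) ⟩
    (f ⋆ g) (suc n) + (f′ ⋆ g) (suc n) ∎

  ⋆-*ˡ : (a : Carrier) (f g : Series) → ((λ k → a * f k) ⋆ g) ≈ˢ (λ n → a * (f ⋆ g) n)
  ⋆-*ˡ a f g zero = trans (+-cong (*-assoc _ _ _) (sym (zeroʳ a))) (sym (distribˡ _ _ _))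
  ⋆-*ˡ a f g (suc n) = begin
    ((λ k → a * f k) ⋆ g) (suc n)                                ≡⟨ ⋆-at-suc _ g n ⟩
    (a * f 0) * g (suc n) + ((λ k → a * f (suc k)) ⋆ g) n          ≈⟨ +-cong (*-assoc _ _ _) (⋆-*ˡ a _ g n) ⟩
    a * (f 0 * g (suc n)) + a * ((λ k → f (suc k)) ⋆ g) n          ≈⟨ sym (distribˡ _ _ _) ⟩
    a * (f 0 * g (suc n) + ((λ k → f (suc k)) ⋆ g) n)              ≡⟨ ≡.cong (a *_) (≡.sym (⋆-at-suc f g n)) ⟩
    a * (f ⋆ g) (suc n)                                          ∎

  ⋆-negˡ : (f g : Series) → ((λ k → - f k) ⋆ g) ≈ˢ (λ n → - (f ⋆ g) n)
  ⋆-negˡ f g zero = trans (+-identityʳ _) (trans (sym (-‿distribˡ-* _ _)) (-‿cong (sym (+-identityʳ _))))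
  ⋆-negˡ f g (suc n) = begin
    ((λ k → - f k) ⋆ g) (suc n)                                ≡⟨ ⋆-at-suc _ g n ⟩
    (- f 0) * g (suc n) + ((λ k → - f (suc k)) ⋆ g) n            ≈⟨ +-cong (sym (-‿distribˡ-* _ _)) (⋆-negˡ _ g n) ⟩
    - (f 0 * g (suc n)) + - ((λ k → f (suc k)) ⋆ g) n            ≈⟨ -‿+-comm _ _ ⟩
    - (f 0 * g (suc n) + ((λ k → f (suc k)) ⋆ g) n)              ≡⟨ ≡.cong -_ (≡.sym (⋆-at-suc f g n)) ⟩
    - (f ⋆ g) (suc n)                                          ∎

  ⋆-sumLˡ : ∀ {B : Set} (l : List B) (fs : B → Series) (g : Series) →
            ((λ k → sumL l (λ b → fs b k)) ⋆ g) ≈ˢ (λ n → sumL l (λ b → (fs b ⋆ g) n))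
  ⋆-sumLˡ []      fs g n = ⋆-zeroˡ g n
  ⋆-sumLˡ (b ∷ l) fs g n = trans (⋆-distribʳ-+ (fs b) _ g n) (+-cong refl (⋆-sumLˡ l fs g n))

  ⋆-comm : (f g : Series) → (f ⋆ g) ≈ˢ (g ⋆ f)
  ⋆-comm f g n = begin
    sumL (upTo (suc n)) (λ k → f k * g (n ∸ k))              ≈⟨ sumL-upTo-reverse n _ ⟩
    sumL (upTo (suc n)) (λ k → f (n ∸ k) * g (n ∸ (n ∸ k)))  ≈⟨ sumL-upTo-cong (suc n) swap ⟩
    sumL (upTo (suc n)) (λ k → g k * f (n ∸ k))              ∎
    where
      swap : ∀ k → k ℕ.< suc n → f (n ∸ k) * g (n ∸ (n ∸ k)) ≈ g k * f (n ∸ k)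
      swap k k<1+n = trans (*-comm _ _) (*-cong (reflexive (≡.cong g (ℕ.m∸[m∸n]≡n (ℕ.≤-pred k<1+n)))) refl)

  ⋆-identityˡ : (f : Series) → (oneˢ ⋆ f) ≈ˢ f
  ⋆-identityˡ f zero    = trans (+-identityʳ _) (*-identityˡ _)
  ⋆-identityˡ f (suc n) = trans (reflexive (⋆-at-suc oneˢ f n)) (trans (+-cong (*-identityˡ _) (⋆-zeroˡ f n)) (+-identityʳ _))

  ⋆-identityʳ : (f : Series) → (f ⋆ oneˢ) ≈ˢ f
  ⋆-identityʳ f n = trans (⋆-comm f oneˢ n) (⋆-identityˡ f n)

  ⋆-shiftˡ : (f g : Series) → (shift f ⋆ g) ≈ˢ shift (f ⋆ g)
  ⋆-shiftˡ f g zero    = trans (+-identityʳ _) (zeroˡ _)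
  ⋆-shiftˡ f g (suc n) = trans (reflexive (⋆-at-suc (shift f) g n)) (trans (+-cong (zeroˡ _) refl) (+-identityˡ _))

  ⋆-assoc : (f g h : Series) → ((f ⋆ g) ⋆ h) ≈ˢ (f ⋆ (g ⋆ h))
  ⋆-assoc f g h zero = trans (+-cong (*-cong (+-identityʳ _) refl) refl)
                             (+-cong (trans (*-assoc _ _ _) (*-cong refl (sym (+-identityʳ _)))) refl)
  ⋆-assoc f g h (suc n) = begin
    ((f ⋆ g) ⋆ h) (suc n)
      ≡⟨ ⋆-at-suc (f ⋆ g) h n ⟩
    (f ⋆ g) 0 * h (suc n) + ((λ k → (f ⋆ g) (suc k)) ⋆ h) n
      ≈⟨ +-cong (*-cong (⋆-at-zero f g) refl) (⋆-congˡ h (λ k → reflexive (⋆-at-suc f g k)) n) ⟩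
    (f 0 * g 0) * h (suc n) + ((λ k → f 0 * g (suc k) + (f′ ⋆ g) k) ⋆ h) n
      ≈⟨ +-cong (*-assoc _ _ _) (⋆-distribʳ-+ _ _ h n) ⟩
    f 0 * (g 0 * h (suc n)) + (((λ k → f 0 * g (suc k)) ⋆ h) n + ((f′ ⋆ g) ⋆ h) n)
      ≈⟨ +-cong refl (+-cong (⋆-*ˡ (f 0) _ h n) (⋆-assoc f′ g h n)) ⟩
    f 0 * (g 0 * h (suc n)) + (f 0 * ((λ k → g (suc k)) ⋆ h) n + (f′ ⋆ (g ⋆ h)) n)
      ≈⟨ sym (+-assoc _ _ _) ⟩
    (f 0 * (g 0 * h (suc n)) + f 0 * ((λ k → g (suc k)) ⋆ h) n) + (f′ ⋆ (g ⋆ h)) n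
      ≈⟨ +-cong (sym (distribˡ _ _ _)) refl ⟩
    f 0 * (g 0 * h (suc n) + ((λ k → g (suc k)) ⋆ h) n) + (f′ ⋆ (g ⋆ h)) n
      ≡⟨ ≡.cong (λ s → f 0 * s + (f′ ⋆ (g ⋆ h)) n) (≡.sym (⋆-at-suc g h n)) ⟩
    f 0 * (g ⋆ h) (suc n) + (f′ ⋆ (g ⋆ h)) n
      ≡⟨ ≡.sym (⋆-at-suc f (g ⋆ h) n) ⟩
    (f ⋆ (g ⋆ h)) (suc n) ∎
    where
      f′ : Series
      f′ k = f (suc k)

module Elementary {c ℓ : Level} (R : CommutativeRing c ℓ) where
  open CommutativeRing R
  open Over R
  open Summation R
  open import Relation.Binary.Reasoning.Setoid setoid

  bits : List Bool
  bits = true ∷ false ∷ []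

  monomial : ∀ {m} → (Fin m → Carrier) → (Fin m → Bool) → Carrier
  monomial {m} x S = prodFin m (λ j → if S j then x j else 1#)

  count-◂ : ∀ m (s : Bool) (S : Fin m → Bool) → count (suc m) (s ◂ S) ≡ (if s then 1 else 0) ℕ.+ count m S
  count-◂ m s S = ≡.cong ((if s then 1 else 0) ℕ.+_)
    (≡.trans (≡.cong ListAction.sum (map-tabulate Fin.suc (λ j → if (s ◂ S) j then 1 else 0)))
             (≡.sym (≡.cong ListAction.sum (map-tabulate (λ i → i) (λ j → if S j then 1 else 0)))))

  ≟-suc : ∀ k i → ⌊ suc k ℕ.≟ suc i ⌋ ≡ ⌊ k ℕ.≟ i ⌋
  ≟-suc k i = ≡.trans (isYes≗does (suc k ℕ.≟ suc i)) (≡.sym (isYes≗does (k ℕ.≟ i)))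

  if-*ˡ : ∀ (b : Bool) a p → (if b then a * p else 0#) ≈ a * (if b then p else 0#)
  if-*ˡ true  a p = refl
  if-*ˡ false a p = sym (zeroʳ a)

  e-split : ∀ m i (x : Fin (suc m) → Carrier) →
            e (suc m) i x ≈ sumMaps m bits (λ S → if ⌊ suc (count m S) ℕ.≟ i ⌋ then x Fin.zero * monomial (λ j → x (Fin.suc j)) S else 0#)
                            + e m i (λ j → x (Fin.suc j))
  e-split m i x = +-cong (cong-count true)
                         (trans (+-identityʳ _) (trans (cong-count false)
                                                       (sumMaps-cong m bits (λ S → without-one ⌊ count m S ℕ.≟ i ⌋))))
    where
      cong-count : ∀ s → sumMaps m bits (λ S → if ⌊ count (suc m) (s ◂ S) ℕ.≟ i ⌋ then monomial x (s ◂ S) else 0#)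
                       ≈ sumMaps m bits (λ S → if ⌊ (if s then 1 else 0) ℕ.+ count m S ℕ.≟ i ⌋ then monomial x (s ◂ S) else 0#)
      cong-count s = sumMaps-cong m bits (λ S →
        reflexive (≡.cong (λ k → if ⌊ k ℕ.≟ i ⌋ then monomial x (s ◂ S) else 0#) (count-◂ m s S)))
      without-one : ∀ b {p} → (if b then 1# * p else 0#) ≈ (if b then p else 0#)
      without-one true  = *-identityˡ _
      without-one false = refl

  e-zero : ∀ m (x : Fin m → Carrier) → e m 0 x ≈ 1#
  e-zero zero    x = refl
  e-zero (suc m) x = begin
    e (suc m) 0 x                                           ≈⟨ e-split m 0 x ⟩
    sumMaps m bits (λ _ → 0#) + e m 0 (λ j → x (Fin.suc j))  ≈⟨ +-cong (sumMaps-zero m bits (λ _ → refl)) (e-zero m _) ⟩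
    0# + 1#                                                 ≈⟨ +-identityˡ 1# ⟩
    1#                                                      ∎

  e-suc-suc : ∀ m i (x : Fin (suc m) → Carrier) →
              e (suc m) (suc i) x ≈ x Fin.zero * e m i (λ j → x (Fin.suc j)) + e m (suc i) (λ j → x (Fin.suc j))
  e-suc-suc m i x = trans (e-split m (suc i) x) (+-cong (trans (sumMaps-cong m bits pull-x₀) (sumMaps-*ˡ m bits _ _)) refl)
    where
      pull-x₀ : ∀ S → (if ⌊ suc (count m S) ℕ.≟ suc i ⌋ then x Fin.zero * monomial (λ j → x (Fin.suc j)) S else 0#)
                    ≈ x Fin.zero * (if ⌊ count m S ℕ.≟ i ⌋ then monomial (λ j → x (Fin.suc j)) S else 0#)
      pull-x₀ S = trans (reflexive (≡.cong (λ b → if b then _ else 0#) (≟-suc (count m S) i))) (if-*ˡ _ _ _)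

module Walks {c ℓ : Level} (R : CommutativeRing c ℓ) where
  open CommutativeRing R
  open Over R
  open Summation R
  open Elementary R using (e-zero; e-suc-suc)
  import Algebra.Properties.CommutativeSemigroup *-commutativeSemigroup as *-Comm
  open import Relation.Binary.Reasoning.Setoid setoid

  -- walk j w b sums, over all walks b = v₀, v₁, …, v_j, the weight
  -- α ^ j · x v₀ ⋯ x v_j · K v₀ v₁ ⋯ K v_{j-1} v_j · w v_j.
  module Weighted {m : ℕ} (x : Fin m → Carrier) (α : Carrier) (K : Fin m → Fin m → Carrier) where

    step : (Fin m → Carrier) → Fin m → Carrier
    step w b = α * (x b * sumL (allFin m) (λ d → K b d * w d))

    walk : ℕ → (Fin m → Carrier) → Fin m → Carrier
    walk zero    w b = x b * w b
    walk (suc j) w   = step (walk j w)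

    step-cong : ∀ {w w′ : Fin m → Carrier} → (∀ d → w d ≈ w′ d) → ∀ b → step w b ≈ step w′ b
    step-cong w≈w′ b = *-cong refl (*-cong refl (sumL-cong (allFin m) (λ d → *-cong refl (w≈w′ d))))

    step-zero : ∀ b → step (λ _ → 0#) b ≈ 0#
    step-zero b = trans (*-cong refl (trans (*-cong refl (sumL-zero (allFin m) (λ d → zeroʳ _))) (zeroʳ _))) (zeroʳ _)

    step-+ : ∀ (w w′ : Fin m → Carrier) b → step (λ d → w d + w′ d) b ≈ step w b + step w′ b
    step-+ w w′ b = trans (*-cong refl (trans (*-cong refl (trans (sumL-cong (allFin m) (λ d → distribˡ _ _ _)) (sumL-+ (allFin m) _ _)))
                                              (distribˡ _ _ _)))
                          (distribˡ _ _ _)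

    step-*ʳ : ∀ (w : Fin m → Carrier) k b → step (λ d → w d * k) b ≈ step w b * k
    step-*ʳ w k b = begin
      α * (x b * sumL (allFin m) (λ d → K b d * (w d * k)))   ≈⟨ *-cong refl (*-cong refl (sumL-cong (allFin m) (λ d → *-Comm.x∙yz≈z∙xy _ _ _))) ⟩
      α * (x b * sumL (allFin m) (λ d → k * (K b d * w d)))   ≈⟨ *-cong refl (*-cong refl (sumL-*ˡ (allFin m) k _)) ⟩
      α * (x b * (k * sumL (allFin m) (λ d → K b d * w d)))   ≈⟨ *-cong refl (*-Comm.x∙yz≈xz∙y _ _ _) ⟩
      α * ((x b * sumL (allFin m) (λ d → K b d * w d)) * k)   ≈⟨ sym (*-assoc _ _ _) ⟩
      step w b * k                                          ∎

    walk-cong : ∀ j {w w′ : Fin m → Carrier} → (∀ d → w d ≈ w′ d) → ∀ b → walk j w b ≈ walk j w′ b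
    walk-cong zero    w≈w′ b = *-cong refl (w≈w′ b)
    walk-cong (suc j) w≈w′   = step-cong (walk-cong j w≈w′)

    walk-zero : ∀ j b → walk j (λ _ → 0#) b ≈ 0#
    walk-zero zero    b = zeroʳ _
    walk-zero (suc j) b = trans (step-cong (walk-zero j) b) (step-zero b)

    walk-+ : ∀ j (w w′ : Fin m → Carrier) b → walk j (λ d → w d + w′ d) b ≈ walk j w b + walk j w′ b
    walk-+ zero    w w′ b = distribˡ _ _ _
    walk-+ (suc j) w w′ b = trans (step-cong (walk-+ j w w′) b) (step-+ _ _ b)

    walk-*ʳ : ∀ j (w : Fin m → Carrier) k b → walk j (λ d → w d * k) b ≈ walk j w b * k
    walk-*ʳ zero    w k b = sym (*-assoc _ _ _)
    walk-*ʳ (suc j) w k b = trans (step-cong (λ d → walk-*ʳ j w k d) b) (step-*ʳ _ k b)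

    walk-sumL : ∀ {B : Set} (l : List B) (ws : B → Fin m → Carrier) (ks : B → Carrier) j b →
                walk j (λ d → sumL l (λ a → ws a d * ks a)) b ≈ sumL l (λ a → walk j (ws a) b * ks a)
    walk-sumL []      ws ks j b = walk-zero j b
    walk-sumL (a ∷ l) ws ks j b = trans (walk-+ j _ _ b) (+-cong (walk-*ʳ j (ws a) (ks a) b) (walk-sumL l ws ks j b))

  less : ∀ {m} → Fin m → Fin m → Carrier
  less b c = if ⌊ b Fin.<? c ⌋ then 1# else 0#

  less-suc : ∀ {m} (b c : Fin m) → less (Fin.suc b) (Fin.suc c) ≡ less b c
  less-suc b c = ≡.cong (λ t → if t then 1# else 0#)
    (≡.trans (isYes≗does (Fin.suc b Fin.<? Fin.suc c)) (≡.sym (isYes≗does (b Fin.<? c))))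

  increasingWalk : ∀ {m} → (Fin m → Carrier) → Carrier → ℕ → (Fin m → Carrier) → Fin m → Carrier
  increasingWalk x α = Weighted.walk x α less

  increasingWalk-suc : ∀ {m} (x : Fin (suc m) → Carrier) α j w b →
                       increasingWalk x α j w (Fin.suc b) ≈ increasingWalk (λ d → x (Fin.suc d)) α j (λ d → w (Fin.suc d)) b
  increasingWalk-suc x α zero    w b = refl
  increasingWalk-suc {m} x α (suc j) w b = *-cong refl (*-cong refl (begin
    sumL (allFin (suc m)) (λ d → less (Fin.suc b) d * increasingWalk x α j w d)
      ≡⟨ sumL-allFin-suc (λ d → less (Fin.suc b) d * increasingWalk x α j w d) ⟩
    0# * increasingWalk x α j w Fin.zero + sumL (allFin m) (λ d → less (Fin.suc b) (Fin.suc d) * increasingWalk x α j w (Fin.suc d))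
      ≈⟨ +-cong (zeroˡ _) (sumL-cong (allFin m) (λ d → *-cong (reflexive (less-suc b d)) (increasingWalk-suc x α j w d))) ⟩
    0# + sumL (allFin m) (λ d → less b d * increasingWalk (λ d → x (Fin.suc d)) α j (λ d → w (Fin.suc d)) d)
      ≈⟨ +-identityˡ _ ⟩
    sumL (allFin m) (λ d → less b d * increasingWalk (λ d → x (Fin.suc d)) α j (λ d → w (Fin.suc d)) d) ∎))

  increasingWalk-zero : ∀ {m} (x : Fin (suc m) → Carrier) α j w →
                        increasingWalk x α (suc j) w Fin.zero
                        ≈ α * (x Fin.zero * sumL (allFin m) (increasingWalk (λ d → x (Fin.suc d)) α j (λ d → w (Fin.suc d))))
  increasingWalk-zero {m} x α j w = *-cong refl (*-cong refl (begin
    sumL (allFin (suc m)) (λ d → less Fin.zero d * increasingWalk x α j w d)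
      ≡⟨ sumL-allFin-suc (λ d → less Fin.zero d * increasingWalk x α j w d) ⟩
    0# * increasingWalk x α j w Fin.zero + sumL (allFin m) (λ d → 1# * increasingWalk x α j w (Fin.suc d))
      ≈⟨ +-cong (zeroˡ _) (sumL-cong (allFin m) (λ d → trans (*-identityˡ _) (increasingWalk-suc x α j w d))) ⟩
    0# + sumL (allFin m) (increasingWalk (λ d → x (Fin.suc d)) α j (λ d → w (Fin.suc d)))
      ≈⟨ +-identityˡ _ ⟩
    sumL (allFin m) (increasingWalk (λ d → x (Fin.suc d)) α j (λ d → w (Fin.suc d))) ∎))

  sum-increasingWalk : ∀ m (x : Fin m → Carrier) α j →
                       sumL (allFin m) (increasingWalk x α j (λ _ → 1#)) ≈ pow α j * e m (suc j) x
  sum-increasingWalk zero    x α j = sym (zeroʳ _)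
  sum-increasingWalk (suc m) x α j = begin
    sumL (allFin (suc m)) (increasingWalk x α j (λ _ → 1#))
      ≡⟨ sumL-allFin-suc (increasingWalk x α j (λ _ → 1#)) ⟩
    increasingWalk x α j (λ _ → 1#) Fin.zero + sumL (allFin m) (λ b → increasingWalk x α j (λ _ → 1#) (Fin.suc b))
      ≈⟨ +-cong refl (trans (sumL-cong (allFin m) (increasingWalk-suc x α j _)) (sum-increasingWalk m x′ α j)) ⟩
    increasingWalk x α j (λ _ → 1#) Fin.zero + pow α j * e m (suc j) x′
      ≈⟨ +-cong (from-smallest j) refl ⟩
    pow α j * (x Fin.zero * e m j x′) + pow α j * e m (suc j) x′
      ≈⟨ sym (distribˡ _ _ _) ⟩
    pow α j * (x Fin.zero * e m j x′ + e m (suc j) x′)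
      ≈⟨ *-cong refl (sym (e-suc-suc m j x)) ⟩
    pow α j * e (suc m) (suc j) x ∎
    where
      x′ : Fin m → Carrier
      x′ d = x (Fin.suc d)
      from-smallest : ∀ j → increasingWalk x α j (λ _ → 1#) Fin.zero ≈ pow α j * (x Fin.zero * e m j x′)
      from-smallest zero    = trans (*-cong refl (sym (e-zero m x′))) (sym (*-identityˡ _))
      from-smallest (suc j) = begin
        increasingWalk x α (suc j) (λ _ → 1#) Fin.zero                ≈⟨ increasingWalk-zero x α j _ ⟩
        α * (x Fin.zero * sumL (allFin m) (increasingWalk x′ α j _))  ≈⟨ *-cong refl (*-cong refl (sum-increasingWalk m x′ α j)) ⟩
        α * (x Fin.zero * (pow α j * e m (suc j) x′))                 ≈⟨ *-cong refl (*-Comm.x∙yz≈y∙xz _ _ _) ⟩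
        α * (pow α j * (x Fin.zero * e m (suc j) x′))                 ≈⟨ sym (*-assoc _ _ _) ⟩
        pow α (suc j) * (x Fin.zero * e m (suc j) x′)                 ∎

module Paths {c ℓ : Level} (R : CommutativeRing c ℓ) (m : ℕ) (x : Fin m → CommutativeRing.Carrier R)
             (q : CommutativeRing.Carrier R) where
  open CommutativeRing R
  open Over R
  open Summation R
  open Convolution R
  open Walks R
  open Ascents using (ascent; pathAsc; asc-path; asc-cycle)
  import Algebra.Properties.CommutativeSemigroup *-commutativeSemigroup as *-Comm
  import Algebra.Properties.CommutativeSemigroup +-commutativeSemigroup as +-Comm
  open import Algebra.Properties.Group +-group using (//-rightDividesʳ)
  open import Relation.Binary.Reasoning.Setoid setoid

  t : Carrier
  t = q + 1#

  pow-+ : ∀ y a b → pow y (a ℕ.+ b) ≈ pow y a * pow y b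
  pow-+ y zero    b = sym (*-identityˡ _)
  pow-+ y (suc a) b = trans (*-cong refl (pow-+ y a b)) (sym (*-assoc _ _ _))

  weight : Fin m → Fin m → Carrier
  weight b c = pow t (ascent b c)

  weight≈1+q·less : ∀ b c → weight b c ≈ 1# + q * less b c
  weight≈1+q·less b c with b Fin.<? c
  ... | yes _ = trans (*-identityʳ _) (trans (+-comm _ _) (+-cong refl (sym (*-identityʳ _))))
  ... | no  _ = sym (trans (+-cong refl (zeroʳ _)) (+-identityʳ _))

  weight-refl : ∀ b → weight b b ≈ 1#
  weight-refl b with b Fin.<? b
  ... | yes b<b = contradiction b<b (ℕ.<-irrefl ≡.refl)
  ... | no  _   = refl

  module Φ = Weighted x 1# weight
  module Ψ = Weighted x q less

  one : Fin m → Carrier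
  one _ = 1#

  ΣΦ : (Fin m → Carrier) → Series
  ΣΦ w l = sumL (allFin m) (Φ.walk l w)

  ΣΨ : (Fin m → Carrier) → Series
  ΣΨ w l = sumL (allFin m) (Ψ.walk l w)

  ψ : Fin m → Series
  ψ b j = Ψ.walk j one b

  A : Series
  A = Aˢ m x q

  P : Series
  P = Pˢ m x q

  pathSum : ℕ → (Fin m → Carrier) → Fin m → Carrier
  pathSum l w b = sumMaps l (allFin m) (λ g →
    (prodFin (suc l) (λ v → x ((b ◂ g) v)) * pow t (pathAsc (b ◂ g))) * w ((b ◂ g) (fromℕ l)))

  pathSum≈walk : ∀ l w b → pathSum l w b ≈ Φ.walk l w b
  pathSum≈walk zero    w b = *-cong (trans (*-identityʳ _) (*-identityʳ _)) refl
  pathSum≈walk (suc l) w b = begin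
    sumL (allFin m) (λ c → sumMaps l (allFin m) (λ g →
      (prodFin (suc (suc l)) (λ v → x ((b ◂ (c ◂ g)) v)) * pow t (pathAsc (b ◂ (c ◂ g)))) * w ((c ◂ g) (fromℕ l))))
      ≈⟨ sumL-cong (allFin m) (λ c → sumMaps-cong l (allFin m) (first-step c)) ⟩
    sumL (allFin m) (λ c → sumMaps l (allFin m) (λ g →
      (x b * weight b c) * ((prodFin (suc l) (λ v → x ((c ◂ g) v)) * pow t (pathAsc (c ◂ g))) * w ((c ◂ g) (fromℕ l)))))
      ≈⟨ sumL-cong (allFin m) (λ c → trans (sumMaps-*ˡ l (allFin m) _ _) (*-cong refl (pathSum≈walk l w c))) ⟩
    sumL (allFin m) (λ c → (x b * weight b c) * Φ.walk l w c)
      ≈⟨ trans (sumL-cong (allFin m) (λ c → *-assoc _ _ _)) (sumL-*ˡ (allFin m) _ _) ⟩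
    x b * sumL (allFin m) (λ c → weight b c * Φ.walk l w c)
      ≈⟨ sym (*-identityˡ _) ⟩
    Φ.walk (suc l) w b ∎
    where
      first-step : ∀ c g →
        (prodFin (suc (suc l)) (λ v → x ((b ◂ (c ◂ g)) v)) * pow t (pathAsc (b ◂ (c ◂ g)))) * w ((c ◂ g) (fromℕ l))
        ≈ (x b * weight b c) * ((prodFin (suc l) (λ v → x ((c ◂ g) v)) * pow t (pathAsc (c ◂ g))) * w ((c ◂ g) (fromℕ l)))
      first-step c g = begin
        ((x b * xs) * pow t (ascent b c ℕ.+ pathAsc (c ◂ g))) * w′   ≈⟨ *-cong (*-cong refl (pow-+ t (ascent b c) _)) refl ⟩
        ((x b * xs) * (weight b c * pow t (pathAsc (c ◂ g)))) * w′   ≈⟨ *-cong (*-Comm.interchange _ _ _ _) refl ⟩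
        ((x b * weight b c) * (xs * pow t (pathAsc (c ◂ g)))) * w′   ≈⟨ *-assoc _ _ _ ⟩
        (x b * weight b c) * ((xs * pow t (pathAsc (c ◂ g))) * w′)   ∎
        where
          xs = prodFin (suc l) (λ v → x ((c ◂ g) v))
          w′ = w ((c ◂ g) (fromℕ l))

  G-path : ∀ l → P (suc l) ≈ ΣΦ one l
  G-path l = sumL-cong (allFin m) (λ b → trans (sumMaps-cong l (allFin m) (λ g →
    trans (reflexive (≡.cong (λ k → prodFin (suc l) (λ v → x ((b ◂ g) v)) * pow t k) (asc-path l (b ◂ g))))
          (sym (*-identityʳ _))))
    (pathSum≈walk l one b))

  G-cycle : ∀ l → Cˢ m x q (suc l) ≈ sumL (allFin m) (λ b → Φ.walk l (λ c → weight c b) b)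
  G-cycle zero    = sumL-cong (allFin m) (λ b → trans (*-identityʳ _) (*-cong refl (sym (weight-refl b))))
  G-cycle (suc l) = sumL-cong (allFin m) (λ b → trans (sumMaps-cong (suc l) (allFin m) (closing-edge b))
                                                       (pathSum≈walk (suc l) (λ c → weight c b) b))
    where
      closing-edge : ∀ b g → let F = b ◂ g in
        prodFin (suc (suc l)) (λ v → x (F v)) * pow t (asc (suc (suc l)) (aC (suc (suc l))) F)
        ≈ (prodFin (suc (suc l)) (λ v → x (F v)) * pow t (pathAsc F)) * weight (F (fromℕ (suc l))) b
      closing-edge b g = begin
        xs * pow t (asc (suc (suc l)) (aC (suc (suc l))) (b ◂ g))
          ≡⟨ ≡.cong (λ k → xs * pow t k) (asc-cycle l (b ◂ g)) ⟩
        xs * pow t (pathAsc (b ◂ g) ℕ.+ ascent (g (fromℕ l)) b)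
          ≈⟨ *-cong refl (pow-+ t (pathAsc (b ◂ g)) _) ⟩
        xs * (pow t (pathAsc (b ◂ g)) * weight (g (fromℕ l)) b)
          ≈⟨ sym (*-assoc _ _ _) ⟩
        (xs * pow t (pathAsc (b ◂ g))) * weight (g (fromℕ l)) b ∎
        where xs = prodFin (suc (suc l)) (λ v → x ((b ◂ g) v))

  ψ-⋆ : ∀ (G : Series) c l →
        (ψ c ⋆ G) l ≈ x c * G l + q * (x c * sumL (allFin m) (λ d → less c d * shift (ψ d ⋆ G) l))
  ψ-⋆ G c zero = begin
    (x c * 1#) * G 0 + 0#                                          ≈⟨ +-identityʳ _ ⟩
    (x c * 1#) * G 0                                               ≈⟨ *-cong (*-identityʳ _) refl ⟩
    x c * G 0                                                      ≈⟨ sym (+-identityʳ _) ⟩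
    x c * G 0 + 0#                                                 ≈⟨ +-cong refl (sym no-second-step) ⟩
    x c * G 0 + q * (x c * sumL (allFin m) (λ d → less c d * 0#))  ∎
    where
      no-second-step : q * (x c * sumL (allFin m) (λ d → less c d * 0#)) ≈ 0#
      no-second-step = trans (*-cong refl (trans (*-cong refl (sumL-zero (allFin m) (λ d → zeroʳ _))) (zeroʳ _))) (zeroʳ _)
  ψ-⋆ G c (suc l) = begin
    (ψ c ⋆ G) (suc l)
      ≡⟨ ⋆-at-suc (ψ c) G l ⟩
    (x c * 1#) * G (suc l) + ((λ k → q * (x c * sumL (allFin m) (λ d → less c d * ψ d k))) ⋆ G) l
      ≈⟨ +-cong (*-cong (*-identityʳ _) refl) (trans (⋆-*ˡ q _ G l) (*-cong refl (⋆-*ˡ (x c) _ G l))) ⟩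
    x c * G (suc l) + q * (x c * ((λ k → sumL (allFin m) (λ d → less c d * ψ d k)) ⋆ G) l)
      ≈⟨ +-cong refl (*-cong refl (*-cong refl (⋆-sumLˡ (allFin m) (λ d k → less c d * ψ d k) G l))) ⟩
    x c * G (suc l) + q * (x c * sumL (allFin m) (λ d → ((λ k → less c d * ψ d k) ⋆ G) l))
      ≈⟨ +-cong refl (*-cong refl (*-cong refl (sumL-cong (allFin m) (λ d → ⋆-*ˡ (less c d) (ψ d) G l)))) ⟩
    x c * G (suc l) + q * (x c * sumL (allFin m) (λ d → less c d * (ψ d ⋆ G) l)) ∎

  -- Expand weight = 1 + q · less at every step: either every step takes q · less, giving an
  -- increasing walk, or there is a first step taking 1, after which the walk is arbitrary.
  walk-decompose : ∀ w l c → Φ.walk l w c ≈ Ψ.walk l w c + shift (ψ c ⋆ ΣΦ w) l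
  walk-decompose w zero    c = sym (+-identityʳ _)
  walk-decompose w (suc l) c = begin
    1# * (x c * sumL (allFin m) (λ d → weight c d * Φ.walk l w d))
      ≈⟨ trans (*-identityˡ _) (*-cong refl split-first-step) ⟩
    x c * (ΣΦ w l + q * (through (Ψ.walk l w) + through broken))
      ≈⟨ rearrange _ _ _ _ ⟩
    q * (x c * through (Ψ.walk l w)) + (x c * ΣΦ w l + q * (x c * through broken))
      ≈⟨ +-cong refl (sym (ψ-⋆ (ΣΦ w) c l)) ⟩
    Ψ.walk (suc l) w c + (ψ c ⋆ ΣΦ w) l ∎
    where
      through : (Fin m → Carrier) → Carrier
      through f = sumL (allFin m) (λ d → less c d * f d)
      broken : Fin m → Carrier
      broken d = shift (ψ d ⋆ ΣΦ w) l
      rearrange : ∀ a g s s′ → a * (g + q * (s + s′)) ≈ q * (a * s) + (a * g + q * (a * s′))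
      rearrange a g s s′ = begin
        a * (g + q * (s + s′))                  ≈⟨ distribˡ _ _ _ ⟩
        a * g + a * (q * (s + s′))              ≈⟨ +-cong refl (*-Comm.x∙yz≈y∙xz _ _ _) ⟩
        a * g + q * (a * (s + s′))              ≈⟨ +-cong refl (trans (*-cong refl (distribˡ _ _ _)) (distribˡ _ _ _)) ⟩
        a * g + (q * (a * s) + q * (a * s′))    ≈⟨ +-Comm.x∙yz≈y∙xz _ _ _ ⟩
        q * (a * s) + (a * g + q * (a * s′))    ∎
      split-first-step : sumL (allFin m) (λ d → weight c d * Φ.walk l w d) ≈ ΣΦ w l + q * (through (Ψ.walk l w) + through broken)
      split-first-step = begin
        sumL (allFin m) (λ d → weight c d * Φ.walk l w d)
          ≈⟨ sumL-cong (allFin m) (λ d → trans (*-cong (weight≈1+q·less c d) refl) (trans (distribʳ _ _ _) (+-cong (*-identityˡ _) (*-assoc _ _ _)))) ⟩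
        sumL (allFin m) (λ d → Φ.walk l w d + q * (less c d * Φ.walk l w d))
          ≈⟨ trans (sumL-+ (allFin m) _ _) (+-cong refl (sumL-*ˡ (allFin m) q _)) ⟩
        ΣΦ w l + q * through (Φ.walk l w)
          ≈⟨ +-cong refl (*-cong refl (trans (sumL-cong (allFin m) (λ d → trans (*-cong refl (walk-decompose w l d)) (distribˡ _ _ _)))
                                             (sumL-+ (allFin m) _ _))) ⟩
        ΣΦ w l + q * (through (Ψ.walk l w) + through broken) ∎

  A≈shift-sumψ : A ≈ˢ shift (λ k → sumL (allFin m) (λ c → ψ c k))
  A≈shift-sumψ zero    = refl
  A≈shift-sumψ (suc j) = sym (sum-increasingWalk m x q j)

  renewal : ∀ w → ΣΦ w ≈ˢ (λ n → ΣΨ w n + (A ⋆ ΣΦ w) n)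
  renewal w n = begin
    ΣΦ w n
      ≈⟨ sumL-cong (allFin m) (walk-decompose w n) ⟩
    sumL (allFin m) (λ c → Ψ.walk n w c + shift (ψ c ⋆ ΣΦ w) n)
      ≈⟨ trans (sumL-+ (allFin m) _ _) (+-cong refl (sum-shift n)) ⟩
    ΣΨ w n + shift (λ k → sumL (allFin m) (λ c → (ψ c ⋆ ΣΦ w) k)) n
      ≈⟨ +-cong refl (shift-cong (λ k → sym (⋆-sumLˡ (allFin m) ψ (ΣΦ w) k)) n) ⟩
    ΣΨ w n + shift ((λ k → sumL (allFin m) (λ c → ψ c k)) ⋆ ΣΦ w) n
      ≈⟨ +-cong refl (sym (⋆-shiftˡ _ (ΣΦ w) n)) ⟩
    ΣΨ w n + (shift (λ k → sumL (allFin m) (λ c → ψ c k)) ⋆ ΣΦ w) n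
      ≈⟨ +-cong refl (⋆-congˡ (ΣΦ w) (λ k → sym (A≈shift-sumψ k)) n) ⟩
    ΣΨ w n + (A ⋆ ΣΦ w) n ∎
    where
      sum-shift : ∀ n → sumL (allFin m) (λ c → shift (ψ c ⋆ ΣΦ w) n) ≈ shift (λ k → sumL (allFin m) (λ c → (ψ c ⋆ ΣΦ w) k)) n
      sum-shift zero    = sumL-zero (allFin m) (λ _ → refl)
      sum-shift (suc n) = refl

  P-zero : P 0 ≈ 1#
  P-zero = *-identityˡ _

  P-renewal : P ≈ˢ (λ n → oneˢ n + (A ⋆ P) n)
  P-renewal zero    = trans P-zero (sym (trans (+-cong refl (trans (⋆-at-zero A P) (zeroˡ _))) (+-identityʳ _)))
  P-renewal (suc l) = begin
    P (suc l)                            ≈⟨ G-path l ⟩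
    ΣΦ one l                             ≈⟨ renewal one l ⟩
    ΣΨ one l + (A ⋆ ΣΦ one) l             ≈⟨ +-cong (sum-increasingWalk m x q l) (⋆-comm A (ΣΦ one) l) ⟩
    A (suc l) + (ΣΦ one ⋆ A) l            ≈⟨ +-cong (sym (trans (*-cong P-zero refl) (*-identityˡ _))) (⋆-congˡ A (λ k → sym (G-path k)) l) ⟩
    P 0 * A (suc l) + ((λ k → P (suc k)) ⋆ A) l ≡⟨ ≡.sym (⋆-at-suc P A l) ⟩
    (P ⋆ A) (suc l)                      ≈⟨ ⋆-comm P A (suc l) ⟩
    (A ⋆ P) (suc l)                      ≈⟨ sym (+-identityˡ _) ⟩
    0# + (A ⋆ P) (suc l)                 ∎

  oneMinusA⋆ : ∀ (f : Series) → (oneMinusAˢ m x q ⋆ f) ≈ˢ (λ n → f n - (A ⋆ f) n)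
  oneMinusA⋆ f n = trans (⋆-distribʳ-+ oneˢ (λ k → - A k) f n) (+-cong (⋆-identityˡ f n) (⋆-negˡ A f n))

  P⋆oneMinusA≈one : (P ⋆ oneMinusAˢ m x q) ≈ˢ oneˢ
  P⋆oneMinusA≈one n = begin
    (P ⋆ oneMinusAˢ m x q) n            ≈⟨ ⋆-comm P _ n ⟩
    (oneMinusAˢ m x q ⋆ P) n            ≈⟨ oneMinusA⋆ P n ⟩
    P n - (A ⋆ P) n                    ≈⟨ +-cong (P-renewal n) refl ⟩
    (oneˢ n + (A ⋆ P) n) - (A ⋆ P) n    ≈⟨ //-rightDividesʳ _ _ ⟩
    oneˢ n                             ∎

  ΣΦ≈P⋆ΣΨ : ∀ w → ΣΦ w ≈ˢ (P ⋆ ΣΨ w)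
  ΣΦ≈P⋆ΣΨ w n = begin
    ΣΦ w n                                 ≈⟨ sym (⋆-identityˡ (ΣΦ w) n) ⟩
    (oneˢ ⋆ ΣΦ w) n                        ≈⟨ ⋆-congˡ (ΣΦ w) (λ k → sym (P⋆oneMinusA≈one k)) n ⟩
    ((P ⋆ oneMinusAˢ m x q) ⋆ ΣΦ w) n      ≈⟨ ⋆-assoc P _ (ΣΦ w) n ⟩
    (P ⋆ (oneMinusAˢ m x q ⋆ ΣΦ w)) n      ≈⟨ ⋆-congʳ P (λ k → trans (oneMinusA⋆ (ΣΦ w) k) (trans (+-cong (renewal w k) refl) (//-rightDividesʳ _ _))) n ⟩
    (P ⋆ ΣΨ w) n                           ∎

module Cycles {c ℓ : Level} (R : CommutativeRing c ℓ) (m : ℕ) (x : Fin m → CommutativeRing.Carrier R)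
              (q : CommutativeRing.Carrier R) where
  open CommutativeRing R
  open Over R
  open Summation R
  open Convolution R
  open Walks R using (less; sum-increasingWalk)
  open Paths R m x q
  import Algebra.Properties.CommutativeSemigroup *-commutativeSemigroup as *-Comm
  open import Algebra.Properties.Ring ring using (-‿+-comm; -‿involutive; -0#≈0#)
  open import Relation.Binary.Reasoning.Setoid setoid

  below : Fin m → Fin m → Carrier
  below b d = less d b

  indicator*≈0 : ∀ {P : Set} (d : Dec P) (a : Carrier) → (P → a ≈ 0#) → (if ⌊ d ⌋ then 1# else 0#) * a ≈ 0#
  indicator*≈0 (yes p) a a≈0 = trans (*-identityˡ _) (a≈0 p)
  indicator*≈0 (no  _) a a≈0 = zeroˡ _

  Ψ-walk-below : ∀ b l d → toℕ b ℕ.≤ toℕ d → Ψ.walk l (below b) d ≈ 0#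
  Ψ-walk-below b zero    d b≤d = trans (*-cong refl (trans (sym (*-identityʳ _))
                                        (indicator*≈0 (d Fin.<? b) 1# (λ d<b → contradiction (ℕ.<-≤-trans d<b b≤d) (ℕ.<-irrefl ≡.refl)))))
                                       (zeroʳ _)
  Ψ-walk-below b (suc l) d b≤d = trans (*-cong refl (*-cong refl (sumL-zero (allFin m) (λ d′ →
      indicator*≈0 (d Fin.<? d′) _ (λ d<d′ → Ψ-walk-below b l d′ (ℕ.≤-trans b≤d (ℕ.<⇒≤ d<d′)))))))
    (trans (*-cong refl (zeroʳ _)) (zeroʳ _))

  -- D l collects the cycles on l + 1 vertices whose closing edge takes the term q · less.
  D : Series
  D l = sumL (allFin m) (λ b → Φ.walk l (below b) b)

  C-split : ∀ l → Cˢ m x q (suc l) ≈ ΣΦ one l + q * D l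
  C-split l = begin
    Cˢ m x q (suc l)
      ≈⟨ G-cycle l ⟩
    sumL (allFin m) (λ b → Φ.walk l (λ d → weight d b) b)
      ≈⟨ sumL-cong (allFin m) expand-closing ⟩
    sumL (allFin m) (λ b → Φ.walk l one b + Φ.walk l (below b) b * q)
      ≈⟨ sumL-+ (allFin m) _ _ ⟩
    ΣΦ one l + sumL (allFin m) (λ b → Φ.walk l (below b) b * q)
      ≈⟨ +-cong refl (trans (sumL-cong (allFin m) (λ b → *-comm _ _)) (sumL-*ˡ (allFin m) q _)) ⟩
    ΣΦ one l + q * D l ∎
    where
      expand-closing : ∀ b → Φ.walk l (λ d → weight d b) b ≈ Φ.walk l one b + Φ.walk l (below b) b * q
      expand-closing b = trans (Φ.walk-cong l (λ d → trans (weight≈1+q·less d b) (+-cong refl (*-comm _ _))) b)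
                               (trans (Φ.walk-+ l one (λ d → less d b * q) b) (+-cong refl (Φ.walk-*ʳ l (below b) q b)))

  V : Series
  V s = sumL (upTo (suc s)) (λ _ → 1#) * A (suc (suc s))

  Ψ-walk-concat : ∀ k j d → Ψ.walk j (λ d′ → sumL (allFin m) (λ b → less d′ b * (q * ψ b k))) d ≈ Ψ.walk (suc (j ℕ.+ k)) one d
  Ψ-walk-concat k zero d = begin
    x d * sumL (allFin m) (λ b → less d b * (q * ψ b k))   ≈⟨ *-cong refl (trans (sumL-cong (allFin m) (λ b → *-Comm.x∙yz≈y∙xz _ _ _)) (sumL-*ˡ (allFin m) q _)) ⟩
    x d * (q * sumL (allFin m) (λ b → less d b * ψ b k))   ≈⟨ *-Comm.x∙yz≈y∙xz _ _ _ ⟩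
    q * (x d * sumL (allFin m) (λ b → less d b * ψ b k))   ∎
  Ψ-walk-concat k (suc j) d = Ψ.step-cong (Ψ-walk-concat k j) d

  -- Both sides count increasing walks on j + k + 2 vertices; on the left they are cut at
  -- their vertex b in position j + 1.
  split-at-b : ∀ j k → q * sumL (allFin m) (λ b → ψ b k * ΣΨ (below b) j) ≈ A (suc (suc (j ℕ.+ k)))
  split-at-b j k = begin
    q * sumL (allFin m) (λ b → ψ b k * ΣΨ (below b) j)
      ≈⟨ sym (sumL-*ˡ (allFin m) q _) ⟩
    sumL (allFin m) (λ b → q * (ψ b k * ΣΨ (below b) j))
      ≈⟨ sumL-cong (allFin m) (λ b → trans (sym (*-assoc _ _ _)) (sym (sumL-*ˡ (allFin m) _ _))) ⟩
    sumL (allFin m) (λ b → sumL (allFin m) (λ d → (q * ψ b k) * Ψ.walk j (below b) d))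
      ≈⟨ sumL-cong (allFin m) (λ b → sumL-cong (allFin m) (λ d → *-comm _ _)) ⟩
    sumL (allFin m) (λ b → sumL (allFin m) (λ d → Ψ.walk j (below b) d * (q * ψ b k)))
      ≈⟨ sumL-comm (allFin m) (allFin m) _ ⟩
    sumL (allFin m) (λ d → sumL (allFin m) (λ b → Ψ.walk j (below b) d * (q * ψ b k)))
      ≈⟨ sumL-cong (allFin m) (λ d → sym (Ψ.walk-sumL (allFin m) below (λ b → q * ψ b k) j d)) ⟩
    sumL (allFin m) (λ d → Ψ.walk j (λ d′ → sumL (allFin m) (λ b → less d′ b * (q * ψ b k))) d)
      ≈⟨ sumL-cong (allFin m) (Ψ-walk-concat k j) ⟩
    sumL (allFin m) (Ψ.walk (suc (j ℕ.+ k)) one)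
      ≈⟨ sum-increasingWalk m x q (suc (j ℕ.+ k)) ⟩
    A (suc (suc (j ℕ.+ k))) ∎

  rotations : ∀ s → q * sumL (allFin m) (λ b → (ψ b ⋆ ΣΨ (below b)) s) ≈ V s
  rotations s = begin
    q * sumL (allFin m) (λ b → sumL (upTo (suc s)) (λ k → ψ b k * ΣΨ (below b) (s ∸ k)))
      ≈⟨ *-cong refl (sumL-comm (allFin m) (upTo (suc s)) _) ⟩
    q * sumL (upTo (suc s)) (λ k → sumL (allFin m) (λ b → ψ b k * ΣΨ (below b) (s ∸ k)))
      ≈⟨ sym (sumL-*ˡ (upTo (suc s)) q _) ⟩
    sumL (upTo (suc s)) (λ k → q * sumL (allFin m) (λ b → ψ b k * ΣΨ (below b) (s ∸ k)))
      ≈⟨ sumL-upTo-cong (suc s) (λ k k≤s → trans (split-at-b (s ∸ k) k)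
                                   (reflexive (≡.cong (λ i → A (suc (suc i))) (ℕ.m∸n+n≡m (ℕ.≤-pred k≤s))))) ⟩
    sumL (upTo (suc s)) (λ _ → A (suc (suc s)))
      ≈⟨ sumL-const (upTo (suc s)) _ ⟩
    V s ∎

  D-shift : ∀ l → D l ≈ sumL (allFin m) (λ b → shift (ψ b ⋆ ΣΦ (below b)) l)
  D-shift l = sumL-cong (allFin m) (λ b →
    trans (walk-decompose (below b) l b) (trans (+-cong (Ψ-walk-below b l b ℕ.≤-refl) refl) (+-identityˡ _)))

  D-zero : D 0 ≈ 0#
  D-zero = trans (D-shift 0) (sumL-zero (allFin m) (λ _ → refl))

  D-suc : ∀ s → q * D (suc s) ≈ (V ⋆ P) s
  D-suc s = begin
    q * D (suc s)
      ≈⟨ *-cong refl (D-shift (suc s)) ⟩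
    q * sumL (allFin m) (λ b → (ψ b ⋆ ΣΦ (below b)) s)
      ≈⟨ *-cong refl (sumL-cong (allFin m) factor-P) ⟩
    q * sumL (allFin m) (λ b → ((ψ b ⋆ ΣΨ (below b)) ⋆ P) s)
      ≈⟨ *-cong refl (sym (⋆-sumLˡ (allFin m) (λ b → ψ b ⋆ ΣΨ (below b)) P s)) ⟩
    q * (Y ⋆ P) s
      ≈⟨ sym (⋆-*ˡ q Y P s) ⟩
    ((λ k → q * Y k) ⋆ P) s
      ≈⟨ ⋆-congˡ P rotations s ⟩
    (V ⋆ P) s ∎
    where
      Y : Series
      Y k = sumL (allFin m) (λ b → (ψ b ⋆ ΣΨ (below b)) k)
      factor-P : ∀ b → (ψ b ⋆ ΣΦ (below b)) s ≈ ((ψ b ⋆ ΣΨ (below b)) ⋆ P) s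
      factor-P b = begin
        (ψ b ⋆ ΣΦ (below b)) s          ≈⟨ ⋆-congʳ (ψ b) (λ k → trans (ΣΦ≈P⋆ΣΨ (below b) k) (⋆-comm P _ k)) s ⟩
        (ψ b ⋆ (ΣΨ (below b) ⋆ P)) s    ≈⟨ sym (⋆-assoc (ψ b) _ P s) ⟩
        ((ψ b ⋆ ΣΨ (below b)) ⋆ P) s    ∎

  C-decomposition : Cˢ m x q ≈ˢ (λ n → (P n - oneˢ n) + shift (shift (V ⋆ P)) n)
  C-decomposition zero = sym (trans (+-identityʳ _) (trans (+-cong P-zero refl) (-‿inverseʳ 1#)))
  C-decomposition (suc zero) = begin
    Cˢ m x q 1              ≈⟨ C-split 0 ⟩
    ΣΦ one 0 + q * D 0      ≈⟨ +-cong (sym (G-path 0)) (trans (*-cong refl D-zero) (zeroʳ q)) ⟩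
    P 1 + 0#                ≈⟨ +-cong (sym (trans (+-cong refl -0#≈0#) (+-identityʳ _))) refl ⟩
    (P 1 - 0#) + 0#         ∎
  C-decomposition (suc (suc s)) = begin
    Cˢ m x q (suc (suc s))                   ≈⟨ C-split (suc s) ⟩
    ΣΦ one (suc s) + q * D (suc s)           ≈⟨ +-cong (sym (G-path (suc s))) (D-suc s) ⟩
    P (suc (suc s)) + (V ⋆ P) s              ≈⟨ +-cong (sym (trans (+-cong refl -0#≈0#) (+-identityʳ _))) refl ⟩
    (P (suc (suc s)) - 0#) + (V ⋆ P) s       ∎

  ⋆-shift²ˡ : ∀ f g → (shift (shift f) ⋆ g) ≈ˢ shift (shift (f ⋆ g))
  ⋆-shift²ˡ f g zero    = ⋆-shiftˡ (shift f) g 0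
  ⋆-shift²ˡ f g (suc n) = trans (⋆-shiftˡ (shift f) g (suc n)) (⋆-shiftˡ f g n)

  A+shift²V≈B : ∀ n → A n + shift (shift V) n ≈ Bˢ m x q n
  A+shift²V≈B zero          = +-identityˡ _
  A+shift²V≈B (suc zero)    = trans (+-identityʳ _) (sym (trans (*-cong (+-identityʳ _) refl) (*-identityˡ _)))
  A+shift²V≈B (suc (suc s)) = begin
    A (suc (suc s)) + V s                                                   ≈⟨ +-cong (sym (*-identityˡ _)) refl ⟩
    1# * A (suc (suc s)) + sumL (upTo (suc s)) (λ _ → 1#) * A (suc (suc s))  ≈⟨ sym (distribʳ _ _ _) ⟩
    (1# + sumL (upTo (suc s)) (λ _ → 1#)) * A (suc (suc s))                  ≡⟨ ≡.cong (_* A (suc (suc s))) (≡.sym (sumL-upTo-suc (suc s) (λ _ → 1#))) ⟩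
    Bˢ m x q (suc (suc s))                                                  ∎

  x-[x-y]≈y : ∀ a b → a - (a - b) ≈ b
  x-[x-y]≈y a b = begin
    a - (a - b)         ≈⟨ +-cong refl (sym (-‿+-comm a (- b))) ⟩
    a + (- a + - - b)   ≈⟨ sym (+-assoc _ _ _) ⟩
    (a - a) + - - b     ≈⟨ +-cong (-‿inverseʳ a) (-‿involutive b) ⟩
    0# + b              ≈⟨ +-identityˡ b ⟩
    b                   ∎

  C⋆oneMinusA≈B : (Cˢ m x q ⋆ oneMinusAˢ m x q) ≈ˢ Bˢ m x q
  C⋆oneMinusA≈B n = begin
    (Cˢ m x q ⋆ 1-A) n
      ≈⟨ ⋆-congˡ 1-A C-decomposition n ⟩
    ((λ k → (P k - oneˢ k) + shift (shift (V ⋆ P)) k) ⋆ 1-A) n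
      ≈⟨ ⋆-distribʳ-+ (λ k → P k - oneˢ k) (shift (shift (V ⋆ P))) 1-A n ⟩
    ((λ k → P k - oneˢ k) ⋆ 1-A) n + (shift (shift (V ⋆ P)) ⋆ 1-A) n
      ≈⟨ +-cong (trans (⋆-distribʳ-+ P (λ k → - oneˢ k) 1-A n) (+-cong refl (⋆-negˡ oneˢ 1-A n))) (⋆-shift²ˡ (V ⋆ P) 1-A n) ⟩
    ((P ⋆ 1-A) n - (oneˢ ⋆ 1-A) n) + shift (shift ((V ⋆ P) ⋆ 1-A)) n
      ≈⟨ +-cong (+-cong (P⋆oneMinusA≈one n) (-‿cong (⋆-identityˡ 1-A n))) (shift-cong (shift-cong V⋆P⋆[1-A]≈V) n) ⟩
    (oneˢ n - 1-A n) + shift (shift V) n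
      ≈⟨ +-cong (x-[x-y]≈y _ _) refl ⟩
    A n + shift (shift V) n
      ≈⟨ A+shift²V≈B n ⟩
    Bˢ m x q n ∎
    where
      1-A : Series
      1-A = oneMinusAˢ m x q
      V⋆P⋆[1-A]≈V : ((V ⋆ P) ⋆ 1-A) ≈ˢ V
      V⋆P⋆[1-A]≈V k = trans (⋆-assoc V P 1-A k) (trans (⋆-congʳ V P⋆oneMinusA≈one k) (⋆-identityʳ V k))

mainTheorem17 : ∀ {c ℓ : Level} (R : CommutativeRing c ℓ) (m : ℕ)
                  (x : Fin m → CommutativeRing.Carrier R) (q : CommutativeRing.Carrier R) →
                  let open Over R in
                  ((Pˢ m x q ⋆ oneMinusAˢ m x q) ≈ˢ oneˢ)
                  × ((Cˢ m x q ⋆ oneMinusAˢ m x q) ≈ˢ Bˢ m x q)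
mainTheorem17 R m x q = Paths.P⋆oneMinusA≈one R m x q , Cycles.C⋆oneMinusA≈B R m x q
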